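{- Let $d>1$, $r\ge 1$, $0<\varepsilon<\varepsilon'<1$, let $\alpha$ be a positive integer with $\alpha>\frac{3}{\varepsilon'-\varepsilon}N^d_r$, and let $G\in\mathcal{A}^d_{\varepsilon,r}$. Then there exists $\tilde g:V(G)\to\operatorname{Prob}(G)$ such that for all $x,z\in V(G)$, $\tilde g(x)(z)=i/\alpha$ for some integer $0\le i\le\alpha$; for every adjacent pair $x,y\in V(G)$, $\|\tilde g(x)-\tilde g(y)\|_1<\varepsilon'$; and for every $x\in V(G)$, $\operatorname{Supp}(\tilde g(x))\subset B_r(x,G)$.
   Context: $Gr_d$ is the set of finite simple graphs of maximum degree at most $d$. $B_r(x,G)$ is the set of vertices at shortest-path distance at most $r$ from $x$. $N^d_r$ denotes the maximum number of vertices of a ball of radius $r$ with maximum degree at most $d$. $\operatorname{Prob}(G)$ is the set of probability measures on $V(G)$; $\|f\|_1=\sum_x|f(x)|$; $\operatorname{Supp}(\mu)=\{z:\mu(z)\ne0\}$. $G\in Gr_d$ is $(\varepsilon,r)$-uniform if there is $\tilde f:V(G)\to\operatorname{Prob}(G)$ with $\|\tilde f(x)-\tilde f(y)\|_1<\varepsilon$ for all adjacent $x,y$ and $\operatorname{Supp}(\tilde f(x))\subset B_r(x,G)$ for all $x$; $\mathcal{A}^d_{\varepsilon,r}$ is the set of such graphs.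
   Formalization: The parameters ε and ε′ are rational, and the map $\tilde f$ witnessing $G\in\mathcal{A}^d_{\varepsilon,r}$ takes rational-valued probability measures. -}

module Defs where

open import Data.Nat as ℕ using (ℕ; zero; suc)
open import Data.Fin using (Fin; zero; suc)
open import Data.Fin.Properties using (_≟_)
open import Data.Bool using (Bool; true; false; _∧_; _∨_; if_then_else_)
open import Relation.Nullary.Decidable using (⌊_⌋)
open import Data.Rational as ℚ using (ℚ; 0ℚ; 1ℚ; _+_; _-_; ∣_∣)
open import Data.Product using (Σ; ∃; _×_; _,_)
open import Relation.Binary.PropositionalEquality using (_≡_; _≢_)
open import Data.Empty using (⊥)

record Graph : Set where
  field
    size   : ℕ
    adj    : Fin size → Fin size → Bool
    sym    : ∀ x y → adj x y ≡ adj y x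
    irrefl : ∀ x → adj x x ≡ false
open Graph public

countFin : ∀ {n} → (Fin n → Bool) → ℕ
countFin {zero}  p = 0
countFin {suc n} p = (if p zero then 1 else 0) ℕ.+ countFin (λ i → p (suc i))

anyFin : ∀ {n} → (Fin n → Bool) → Bool
anyFin {zero}  p = false
anyFin {suc n} p = p zero ∨ anyFin (λ i → p (suc i))

degree : (G : Graph) → Fin (size G) → ℕ
degree G x = countFin (adj G x)

InGr : ℕ → Graph → Set
InGr d G = ∀ x → degree G x ℕ.≤ d

within : (G : Graph) → ℕ → Fin (size G) → Fin (size G) → Bool
within G zero    x y = ⌊ x ≟ y ⌋
within G (suc r) x y = ⌊ x ≟ y ⌋ ∨ anyFin (λ z → adj G x z ∧ within G r z y)

ballSize : (G : Graph) → ℕ → Fin (size G) → ℕ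
ballSize G r x = countFin (within G r x)

IsMaxBallSize : ℕ → ℕ → ℕ → Set
IsMaxBallSize d r M =
  (∀ (G : Graph) → InGr d G → ∀ x → ballSize G r x ℕ.≤ M)
  × Σ Graph (λ G → InGr d G × ∃ λ x → ballSize G r x ≡ M)

sumFin : ∀ {n} → (Fin n → ℚ) → ℚ
sumFin {zero}  f = 0ℚ
sumFin {suc n} f = f zero + sumFin (λ i → f (suc i))

IsProb : (G : Graph) → (Fin (size G) → ℚ) → Set
IsProb G μ = (∀ z → 0ℚ ℚ.≤ μ z) × sumFin μ ≡ 1ℚ

dist1 : ∀ {n} → (Fin n → ℚ) → (Fin n → ℚ) → ℚ
dist1 μ ν = sumFin (λ z → ∣ μ z - ν z ∣)

SuppIn : (G : Graph) → ℕ → Fin (size G) → (Fin (size G) → ℚ) → Set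
SuppIn G r x μ = ∀ z → μ z ≢ 0ℚ → within G r x z ≡ true

IsUniformMap : (G : Graph) → ℚ → ℕ → (Fin (size G) → Fin (size G) → ℚ) → Set
IsUniformMap G ε r f =
  (∀ x → IsProb G (f x))
  × (∀ x y → adj G x y ≡ true → dist1 (f x) (f y) ℚ.< ε)
  × (∀ x → SuppIn G r x (f x))

VMap : Graph → Set
VMap G = Fin (size G) → Fin (size G) → ℚ

InA : ℕ → ℚ → ℕ → Graph → Set
InA d ε r G = InGr d G × Σ (Fin (size G) → Fin (size G) → ℚ) (IsUniformMap G ε r)

-- Round each f x to multiples of 1/α by rounding its partial sums down to the grid (1/α)ℕ and
-- taking differences. The resulting masses are nonnegative, telescope to ⌊α·1⌋/α = 1, vanish where
-- f x vanishes, and each is within 1/α of the original one; so ‖g x − f x‖₁ ≤ |B_r(x)|/α ≤ N/α,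
-- and the triangle inequality gives ‖g x − g y‖₁ < ε + 2N/α < ε' for adjacent x, y.
module Submission where

open import Defs hiding (sym)
open import Data.Nat as ℕ using (ℕ; NonZero; zero; suc; z≤n)
import Data.Nat.Properties as ℕ
open import Data.Nat.DivMod using (m/n*n≤m; m≡m%n+[m/n]*n; m%n<n; n/1≡n)
open import Data.Integer as ℤ using (+_; -[1+_])
import Data.Integer.Properties as ℤ
open import Data.Rational as ℚ using (ℚ; mkℚ; 0ℚ; 1ℚ; _+_; _-_; -_; _*_; _/_; ∣_∣; toℚᵘ)
open import Data.Rational.Properties
open import Data.Rational.Solver using (module +-*-Solver)
open import Data.Rational.Unnormalised as ℚᵘ using (mkℚᵘ; *≤*; *<*; *≡*)
import Data.Rational.Unnormalised.Properties as ℚᵘ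
open import Data.Fin using (Fin; zero; suc)
open import Data.Bool using (Bool; true; false; if_then_else_)
open import Data.Product using (Σ; ∃; _×_; _,_; proj₁; proj₂)
open import Data.Sum using (inj₁; inj₂)
open import Relation.Binary.PropositionalEquality
open import Relation.Nullary using (yes; no; contradiction)
open import Relation.Nullary.Decidable using (decidable-stable)
import Data.Empty.Irrelevant as Irrelevant

open +-*-Solver

p≤q⇒0≤q-p : ∀ {p q} → p ℚ.≤ q → 0ℚ ℚ.≤ q - p
p≤q⇒0≤q-p {p} {q} p≤q = subst (ℚ._≤ q - p) (+-inverseʳ p) (+-monoˡ-≤ (- p) p≤q)

p<q+r⇒p-r<q : ∀ {p q r} → p ℚ.< q + r → p - r ℚ.< q
p<q+r⇒p-r<q {p} {q} {r} p<q+r =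
  subst (p - r ℚ.<_) (solve 2 (λ q r → (q :+ r) :- r := q) refl q r) (+-monoˡ-< (- r) p<q+r)

0≤q⇒p-q≤p : ∀ {p q} → 0ℚ ℚ.≤ q → p - q ℚ.≤ p
0≤q⇒p-q≤p {p} {q} 0≤q = subst (p - q ℚ.≤_) (+-identityʳ p) (+-monoʳ-≤ p (neg-antimono-≤ 0≤q))

0≤q⇒p≤p+q : ∀ {p q} → 0ℚ ℚ.≤ q → p ℚ.≤ p + q
0≤q⇒p≤p+q {p} {q} 0≤q = subst (ℚ._≤ p + q) (+-identityʳ p) (+-monoʳ-≤ p 0≤q)

0≤q⇒p≤q+p : ∀ {p q} → 0ℚ ℚ.≤ q → p ℚ.≤ q + p
0≤q⇒p≤q+p {p} {q} 0≤q = subst (ℚ._≤ q + p) (+-identityˡ p) (+-monoˡ-≤ p 0≤q)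

-[p-q]≡q-p : ∀ p q → - (p - q) ≡ q - p
-[p-q]≡q-p = solve 2 (λ p q → :- (p :- q) := q :- p) refl

0≤p<r∧0≤q<r⇒∣p-q∣<r : ∀ {p q r} → 0ℚ ℚ.≤ p → p ℚ.< r → 0ℚ ℚ.≤ q → q ℚ.< r → ∣ p - q ∣ ℚ.< r
0≤p<r∧0≤q<r⇒∣p-q∣<r {p} {q} {r} 0≤p p<r 0≤q q<r with ∣p∣≡p∨∣p∣≡-p (p - q)
... | inj₁ ∣p-q∣≡p-q = subst (ℚ._< r) (sym ∣p-q∣≡p-q) (≤-<-trans (0≤q⇒p-q≤p 0≤q) p<r)
... | inj₂ ∣p-q∣≡q-p = subst (ℚ._< r) (sym (trans ∣p-q∣≡q-p (-[p-q]≡q-p p q)))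
                              (≤-<-trans (0≤q⇒p-q≤p 0≤p) q<r)

∣p-q∣≡∣q-p∣ : ∀ p q → ∣ p - q ∣ ≡ ∣ q - p ∣
∣p-q∣≡∣q-p∣ p q = trans (sym (∣-p∣≡∣p∣ (p - q))) (cong ∣_∣ (-[p-q]≡q-p p q))

∣p-r∣≤∣p-q∣+∣q-r∣ : ∀ p q r → ∣ p - r ∣ ℚ.≤ ∣ p - q ∣ + ∣ q - r ∣
∣p-r∣≤∣p-q∣+∣q-r∣ p q r = subst (λ s → ∣ s ∣ ℚ.≤ ∣ p - q ∣ + ∣ q - r ∣)
  (solve 3 (λ p q r → (p :- q) :+ (q :- r) := p :- r) refl p q r) (∣p+q∣≤∣p∣+∣q∣ (p - q) (q - r))

sumFin-cong : ∀ {n} {f g : Fin n → ℚ} → (∀ i → f i ≡ g i) → sumFin f ≡ sumFin g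
sumFin-cong {zero}  f≡g = refl
sumFin-cong {suc n} f≡g = cong₂ _+_ (f≡g zero) (sumFin-cong (λ i → f≡g (suc i)))

sumFin-mono : ∀ {n} {f g : Fin n → ℚ} → (∀ i → f i ℚ.≤ g i) → sumFin f ℚ.≤ sumFin g
sumFin-mono {zero}  f≤g = ≤-refl
sumFin-mono {suc n} f≤g = +-mono-≤ (f≤g zero) (sumFin-mono (λ i → f≤g (suc i)))

sumFin-+ : ∀ {n} (f g : Fin n → ℚ) → sumFin (λ i → f i + g i) ≡ sumFin f + sumFin g
sumFin-+ {zero}  f g = refl
sumFin-+ {suc n} f g = begin
  (f zero + g zero) + sumFin (λ i → f (suc i) + g (suc i))
    ≡⟨ cong (λ s → (f zero + g zero) + s) (sumFin-+ (λ i → f (suc i)) (λ i → g (suc i))) ⟩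
  (f zero + g zero) + (F + G)
    ≡⟨ solve 4 (λ a b c d → (a :+ b) :+ (c :+ d) := (a :+ c) :+ (b :+ d)) refl (f zero) (g zero) F G ⟩
  (f zero + F) + (g zero + G) ∎
  where
  open ≡-Reasoning
  F = sumFin (λ i → f (suc i))
  G = sumFin (λ i → g (suc i))

sumFin-nonneg : ∀ {n} {f : Fin n → ℚ} → (∀ i → 0ℚ ℚ.≤ f i) → 0ℚ ℚ.≤ sumFin f
sumFin-nonneg {zero}  f≥0 = ≤-refl
sumFin-nonneg {suc n} f≥0 = +-mono-≤ (f≥0 zero) (sumFin-nonneg (λ i → f≥0 (suc i)))

term≤sumFin : ∀ {n} {f : Fin n → ℚ} → (∀ i → 0ℚ ℚ.≤ f i) → ∀ i → f i ℚ.≤ sumFin f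
term≤sumFin f≥0 zero    = 0≤q⇒p≤p+q (sumFin-nonneg (λ i → f≥0 (suc i)))
term≤sumFin f≥0 (suc i) = ≤-trans (term≤sumFin (λ j → f≥0 (suc j)) i) (0≤q⇒p≤q+p (f≥0 zero))

dist1-sym : ∀ {n} (μ ν : Fin n → ℚ) → dist1 μ ν ≡ dist1 ν μ
dist1-sym μ ν = sumFin-cong (λ z → ∣p-q∣≡∣q-p∣ (μ z) (ν z))

dist1-triangle : ∀ {n} (μ ν ρ : Fin n → ℚ) → dist1 μ ρ ℚ.≤ dist1 μ ν + dist1 ν ρ
dist1-triangle μ ν ρ = begin
  dist1 μ ρ                                          ≤⟨ sumFin-mono (λ z → ∣p-r∣≤∣p-q∣+∣q-r∣ (μ z) (ν z) (ρ z)) ⟩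
  sumFin (λ z → ∣ μ z - ν z ∣ + ∣ ν z - ρ z ∣)       ≡⟨ sumFin-+ (λ z → ∣ μ z - ν z ∣) (λ z → ∣ ν z - ρ z ∣) ⟩
  dist1 μ ν + dist1 ν ρ                              ∎
  where open ≤-Reasoning

IsUniformMap-mono : ∀ {G ε ε' r g} → ε ℚ.≤ ε' → IsUniformMap G ε r g → IsUniformMap G ε' r g
IsUniformMap-mono ε≤ε' (g-dist , g-close , g-supp) =
  g-dist , (λ x y x~y → <-≤-trans (g-close x y x~y) ε≤ε') , g-supp

IsDistribution : ∀ {n} → (Fin n → ℚ) → Set
IsDistribution μ = (∀ z → 0ℚ ℚ.≤ μ z) × sumFin μ ≡ 1ℚ

m<[1+m/n]*n : ∀ m n .{{_ : NonZero n}} → m ℕ.< suc (m ℕ./ n) ℕ.* n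
m<[1+m/n]*n m n = begin-strict
  m                             ≡⟨ m≡m%n+[m/n]*n m n ⟩
  m ℕ.% n ℕ.+ (m ℕ./ n) ℕ.* n   <⟨ ℕ.+-monoˡ-< ((m ℕ./ n) ℕ.* n) (m%n<n m n) ⟩
  suc (m ℕ./ n) ℕ.* n           ∎
  where open ℕ.≤-Reasoning

module Grid (k : ℕ) where

  α : ℕ
  α = suc k

  -- Opaque, so that unification never unfolds the gcd-normalising division _/_.
  opaque
    ι : ℕ → ℚ
    ι i = (+ i) / α

    ι≡i/α : ∀ i → ι i ≡ (+ i) / α
    ι≡i/α i = refl

    toℚᵘ-ι : ∀ i → toℚᵘ (ι i) ℚᵘ.≃ mkℚᵘ (+ i) k
    toℚᵘ-ι i = toℚᵘ-fromℚᵘ (mkℚᵘ (+ i) k)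

    ι-0 : ι 0 ≡ 0ℚ
    ι-0 = 0/n≡0 α

  ι-+ : ∀ a b → ι (a ℕ.+ b) ≡ ι a + ι b
  ι-+ a b = toℚᵘ-injective (begin-equality
    toℚᵘ (ι (a ℕ.+ b))               ≃⟨ toℚᵘ-ι (a ℕ.+ b) ⟩
    mkℚᵘ (+ (a ℕ.+ b)) k             ≃⟨ *≡* cross ⟩
    mkℚᵘ (+ a) k ℚᵘ.+ mkℚᵘ (+ b) k   ≃⟨ ℚᵘ.+-cong (toℚᵘ-ι a) (toℚᵘ-ι b) ⟨
    toℚᵘ (ι a) ℚᵘ.+ toℚᵘ (ι b)       ≃⟨ toℚᵘ-homo-+ (ι a) (ι b) ⟨
    toℚᵘ (ι a + ι b)                 ∎)
    where
    open ℚᵘ.≤-Reasoning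
    cross : + (a ℕ.+ b) ℤ.* (+ α ℤ.* + α) ≡ (+ a ℤ.* + α ℤ.+ + b ℤ.* + α) ℤ.* + α
    cross = trans (sym (ℤ.*-assoc (+ (a ℕ.+ b)) (+ α) (+ α)))
                  (cong (λ s → s ℤ.* + α) (ℤ.*-distribʳ-+ (+ α) (+ a) (+ b)))

  ι-mono-≤ : ∀ {a b} → a ℕ.≤ b → ι a ℚ.≤ ι b
  ι-mono-≤ {a} {b} a≤b = toℚᵘ-cancel-≤ (begin
    toℚᵘ (ι a)    ≃⟨ toℚᵘ-ι a ⟩
    mkℚᵘ (+ a) k  ≤⟨ *≤* (ℤ.*-monoʳ-≤-nonNeg (+ α) (ℤ.+≤+ a≤b)) ⟩
    mkℚᵘ (+ b) k  ≃⟨ toℚᵘ-ι b ⟨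
    toℚᵘ (ι b)    ∎)
    where open ℚᵘ.≤-Reasoning

  ι-cancel-≤ : ∀ {a b} → ι a ℚ.≤ ι b → a ℕ.≤ b
  ι-cancel-≤ {a} {b} ιa≤ιb = ℤ.drop‿+≤+ (ℤ.*-cancelʳ-≤-pos (+ a) (+ b) (+ α) (ℚᵘ.drop-*≤* (begin
    mkℚᵘ (+ a) k  ≃⟨ toℚᵘ-ι a ⟨
    toℚᵘ (ι a)    ≤⟨ toℚᵘ-mono-≤ ιa≤ιb ⟩
    toℚᵘ (ι b)    ≃⟨ toℚᵘ-ι b ⟩
    mkℚᵘ (+ b) k  ∎)))
    where open ℚᵘ.≤-Reasoning

  ι-cancel-< : ∀ {a b} → ι a ℚ.< ι b → a ℕ.< b
  ι-cancel-< {a} {b} ιa<ιb = ℤ.drop‿+<+ (ℤ.*-cancelʳ-<-nonNeg (+ α) (ℚᵘ.drop-*<* (begin-strict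
    mkℚᵘ (+ a) k  ≃⟨ toℚᵘ-ι a ⟨
    toℚᵘ (ι a)    <⟨ toℚᵘ-mono-< ιa<ιb ⟩
    toℚᵘ (ι b)    ≃⟨ toℚᵘ-ι b ⟩
    mkℚᵘ (+ b) k  ∎)))
    where open ℚᵘ.≤-Reasoning

  ι-α : ι α ≡ 1ℚ
  ι-α = toℚᵘ-injective (ℚᵘ.≃-trans (toℚᵘ-ι α) (*≡* (ℤ.*-comm (+ α) (+ 1))))

  ι-nonneg : ∀ i → 0ℚ ℚ.≤ ι i
  ι-nonneg i = subst (ℚ._≤ ι i) ι-0 (ι-mono-≤ z≤n)

  ι-∸ : ∀ {a b} → a ℕ.≤ b → ι (b ℕ.∸ a) ≡ ι b - ι a
  ι-∸ {a} {b} a≤b = begin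
    ι (b ℕ.∸ a)                 ≡⟨ solve 2 (λ x y → x := (x :+ y) :- y) refl (ι (b ℕ.∸ a)) (ι a) ⟩
    (ι (b ℕ.∸ a) + ι a) - ι a   ≡⟨ cong (_- ι a) (ι-+ (b ℕ.∸ a) a) ⟨
    ι (b ℕ.∸ a ℕ.+ a) - ι a     ≡⟨ cong (λ c → ι c - ι a) (ℕ.m∸n+n≡m a≤b) ⟩
    ι b - ι a                   ∎
    where open ≡-Reasoning

  ι[n]*α≡n : ∀ n → ι n * ((+ α) / 1) ≡ (+ n) / 1
  ι[n]*α≡n n = toℚᵘ-injective (begin-equality
    toℚᵘ (ι n * ((+ α) / 1))                  ≃⟨ toℚᵘ-homo-* (ι n) ((+ α) / 1) ⟩
    toℚᵘ (ι n) ℚᵘ.* toℚᵘ ((+ α) / 1)          ≃⟨ ℚᵘ.*-cong (toℚᵘ-ι n) (toℚᵘ-fromℚᵘ (mkℚᵘ (+ α) 0)) ⟩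
    mkℚᵘ (+ n) k ℚᵘ.* mkℚᵘ (+ α) 0            ≃⟨ *≡* cross ⟩
    mkℚᵘ (+ n) 0                              ≃⟨ toℚᵘ-fromℚᵘ (mkℚᵘ (+ n) 0) ⟨
    toℚᵘ ((+ n) / 1)                          ∎)
    where
    open ℚᵘ.≤-Reasoning
    cross : (+ n ℤ.* + α) ℤ.* + 1 ≡ + n ℤ.* (+ α ℤ.* + 1)
    cross = ℤ.*-assoc (+ n) (+ α) (+ 1)

  n<q*α⇒ι[n]<q : ∀ {n q} → (+ n) / 1 ℚ.< q * ((+ α) / 1) → ι n ℚ.< q
  n<q*α⇒ι[n]<q {n} n<q*α = *-cancelʳ-<-nonNeg ((+ α) / 1) ⦃ normalize-nonNeg α 1 ⦄ (subst (ℚ._< _) (sym (ι[n]*α≡n n)) n<q*α)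

  ⌊_·α⌋ : ℚ → ℕ
  ⌊ mkℚ (+ n)    d-1 _ ·α⌋ = (α ℕ.* n) ℕ./ suc d-1
  ⌊ mkℚ -[1+ _ ] _   _ ·α⌋ = 0

  ⌊⌋-lower : ∀ {q} → 0ℚ ℚ.≤ q → ι ⌊ q ·α⌋ ℚ.≤ q
  ⌊⌋-lower {mkℚ (+ n) d-1 _} _ = toℚᵘ-cancel-≤ (begin
    toℚᵘ (ι m)         ≃⟨ toℚᵘ-ι m ⟩
    mkℚᵘ (+ m) k       ≤⟨ *≤* (subst₂ ℤ._≤_ (ℤ.pos-* m (suc d-1)) (ℤ.pos-* n α) (ℤ.+≤+ m*D≤n*α)) ⟩
    mkℚᵘ (+ n) d-1     ∎)
    where
    open ℚᵘ.≤-Reasoning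
    m = (α ℕ.* n) ℕ./ suc d-1
    m*D≤n*α : m ℕ.* suc d-1 ℕ.≤ n ℕ.* α
    m*D≤n*α = subst (m ℕ.* suc d-1 ℕ.≤_) (ℕ.*-comm α n) (m/n*n≤m (α ℕ.* n) (suc d-1))
  ⌊⌋-lower {mkℚ -[1+ _ ] _ _} (ℚ.*≤* ())

  ⌊⌋-upper : ∀ q → q ℚ.< ι (suc ⌊ q ·α⌋)
  ⌊⌋-upper (mkℚ (+ n) d-1 _) = toℚᵘ-cancel-< (begin-strict
    mkℚᵘ (+ n) d-1         <⟨ *<* (subst₂ ℤ._<_ (ℤ.pos-* n α) (ℤ.pos-* (suc m) D) (ℤ.+<+ n*α<[1+m]*D)) ⟩
    mkℚᵘ (+ suc m) k       ≃⟨ toℚᵘ-ι (suc m) ⟨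
    toℚᵘ (ι (suc m))       ∎)
    where
    open ℚᵘ.≤-Reasoning
    D = suc d-1
    m = (α ℕ.* n) ℕ./ D
    n*α<[1+m]*D : n ℕ.* α ℕ.< suc m ℕ.* D
    n*α<[1+m]*D = subst (ℕ._< suc m ℕ.* D) (ℕ.*-comm α n) (m<[1+m/n]*n (α ℕ.* n) D)
  ⌊⌋-upper q@(mkℚ -[1+ _ ] _ _) = <-≤-trans (ℚ.*<* ℤ.-<+) (ι-nonneg (suc ⌊ q ·α⌋))

  ⌊⌋-residue : ∀ {q} → 0ℚ ℚ.≤ q → 0ℚ ℚ.≤ q - ι ⌊ q ·α⌋ × q - ι ⌊ q ·α⌋ ℚ.< ι 1
  ⌊⌋-residue {q} 0≤q =
    p≤q⇒0≤q-p (⌊⌋-lower 0≤q) ,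
    p<q+r⇒p-r<q (subst (q ℚ.<_) (ι-+ 1 ⌊ q ·α⌋) (⌊⌋-upper q))

  ⌊⌋-mono : ∀ {p q} → 0ℚ ℚ.≤ p → p ℚ.≤ q → ⌊ p ·α⌋ ℕ.≤ ⌊ q ·α⌋
  ⌊⌋-mono {p} {q} 0≤p p≤q =
    ℕ.s≤s⁻¹ (ι-cancel-< (≤-<-trans (⌊⌋-lower 0≤p) (≤-<-trans p≤q (⌊⌋-upper q))))

  ⌊0⌋ : ⌊ 0ℚ ·α⌋ ≡ 0
  ⌊0⌋ = trans (n/1≡n (α ℕ.* 0)) (ℕ.*-zeroʳ α)

  ⌊1⌋ : ⌊ 1ℚ ·α⌋ ≡ α
  ⌊1⌋ = trans (n/1≡n (α ℕ.* 1)) (ℕ.*-identityʳ α)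

  ⌊+⌋∸⌊⌋-error : ∀ {c h} → 0ℚ ℚ.≤ c → 0ℚ ℚ.≤ h →
                 ∣ ι (⌊ c + h ·α⌋ ℕ.∸ ⌊ c ·α⌋) - h ∣ ℚ.< ι 1
  ⌊+⌋∸⌊⌋-error {c} {h} 0≤c 0≤h =
    subst (λ s → ∣ s ∣ ℚ.< ι 1) (sym residues)
      (0≤p<r∧0≤q<r⇒∣p-q∣<r 0≤r r<1 0≤r' r'<1)
    where
    A B : ℚ
    A = ι ⌊ c ·α⌋
    B = ι ⌊ c + h ·α⌋
    0≤r : 0ℚ ℚ.≤ c - A
    0≤r = proj₁ (⌊⌋-residue 0≤c)
    r<1 : c - A ℚ.< ι 1
    r<1 = proj₂ (⌊⌋-residue 0≤c)
    0≤r' : 0ℚ ℚ.≤ (c + h) - B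
    0≤r' = proj₁ (⌊⌋-residue (+-mono-≤ 0≤c 0≤h))
    r'<1 : (c + h) - B ℚ.< ι 1
    r'<1 = proj₂ (⌊⌋-residue (+-mono-≤ 0≤c 0≤h))
    residues : ι (⌊ c + h ·α⌋ ℕ.∸ ⌊ c ·α⌋) - h ≡ (c - A) - ((c + h) - B)
    residues = begin
      ι (⌊ c + h ·α⌋ ℕ.∸ ⌊ c ·α⌋) - h  ≡⟨ cong (_- h) (ι-∸ (⌊⌋-mono 0≤c (0≤q⇒p≤p+q 0≤h))) ⟩
      (B - A) - h                      ≡⟨ solve 4 (λ A B c h → (B :- A) :- h := (c :- A) :- ((c :+ h) :- B)) refl A B c h ⟩
      (c - A) - ((c + h) - B)          ∎
      where open ≡-Reasoning

  -- roundFrom c h i = ⌊α(c + h₀ + … + hᵢ)⌋ − ⌊α(c + h₀ + … + hᵢ₋₁)⌋: rounding the partial sums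
  -- rather than the terms makes the rounded values telescope.
  roundFrom : ∀ {n} → ℚ → (Fin n → ℚ) → Fin n → ℕ
  roundFrom c h zero    = ⌊ c + h zero ·α⌋ ℕ.∸ ⌊ c ·α⌋
  roundFrom c h (suc i) = roundFrom (c + h zero) (λ j → h (suc j)) i

  roundFrom-zero : ∀ {n} c (h : Fin n → ℚ) i → h i ≡ 0ℚ → roundFrom c h i ≡ 0
  roundFrom-zero c h zero    h₀≡0 rewrite h₀≡0 | +-identityʳ c = ℕ.n∸n≡0 ⌊ c ·α⌋
  roundFrom-zero c h (suc i) hᵢ≡0 = roundFrom-zero (c + h zero) (λ j → h (suc j)) i hᵢ≡0

  roundFrom-error : ∀ {n c} {h : Fin n → ℚ} → 0ℚ ℚ.≤ c → (∀ i → 0ℚ ℚ.≤ h i) →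
                    ∀ i → ∣ ι (roundFrom c h i) - h i ∣ ℚ.< ι 1
  roundFrom-error 0≤c h≥0 zero    = ⌊+⌋∸⌊⌋-error 0≤c (h≥0 zero)
  roundFrom-error 0≤c h≥0 (suc i) = roundFrom-error (+-mono-≤ 0≤c (h≥0 zero)) (λ j → h≥0 (suc j)) i

  roundFrom-sum : ∀ {n c} {h : Fin n → ℚ} → 0ℚ ℚ.≤ c → (∀ i → 0ℚ ℚ.≤ h i) →
                  sumFin (λ i → ι (roundFrom c h i)) + ι ⌊ c ·α⌋ ≡ ι ⌊ c + sumFin h ·α⌋
  roundFrom-sum {zero}  {c} 0≤c h≥0 = trans (+-identityˡ (ι ⌊ c ·α⌋)) (cong (λ s → ι ⌊ s ·α⌋) (sym (+-identityʳ c)))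
  roundFrom-sum {suc n} {c} {h} 0≤c h≥0 = begin
    (ι r₀ + R) + ι ⌊ c ·α⌋          ≡⟨ solve 3 (λ a b c → (a :+ b) :+ c := b :+ (a :+ c)) refl (ι r₀) R (ι ⌊ c ·α⌋) ⟩
    R + (ι r₀ + ι ⌊ c ·α⌋)          ≡⟨ cong (λ s → R + s) (ι-+ r₀ ⌊ c ·α⌋) ⟨
    R + ι (r₀ ℕ.+ ⌊ c ·α⌋)          ≡⟨ cong (λ s → R + ι s) (ℕ.m∸n+n≡m (⌊⌋-mono 0≤c (0≤q⇒p≤p+q (h≥0 zero)))) ⟩
    R + ι ⌊ c + h zero ·α⌋          ≡⟨ roundFrom-sum (+-mono-≤ 0≤c (h≥0 zero)) (λ j → h≥0 (suc j)) ⟩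
    ι ⌊ (c + h zero) + H ·α⌋        ≡⟨ cong (λ s → ι ⌊ s ·α⌋) (+-assoc c (h zero) H) ⟩
    ι ⌊ c + sumFin h ·α⌋            ∎
    where
    open ≡-Reasoning
    r₀ = roundFrom c h zero
    H  = sumFin (λ j → h (suc j))
    R  = sumFin (λ j → ι (roundFrom (c + h zero) (λ j → h (suc j)) j))

  sumFin-indicator : ∀ {n} (S : Fin n → Bool) → sumFin (λ i → if S i then ι 1 else 0ℚ) ≡ ι (countFin S)
  sumFin-indicator {zero}  S = sym ι-0
  sumFin-indicator {suc n} S with S zero
  ... | true  = trans (cong (λ s → ι 1 + s) (sumFin-indicator (λ i → S (suc i))))
                      (sym (ι-+ 1 (countFin (λ i → S (suc i)))))
  ... | false = trans (+-identityˡ _) (sumFin-indicator (λ i → S (suc i)))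

  quantise : ∀ {n} → (Fin n → ℚ) → Fin n → ℚ
  quantise μ z = ι (roundFrom 0ℚ μ z)

  quantise-zero : ∀ {n} (μ : Fin n → ℚ) z → μ z ≡ 0ℚ → quantise μ z ≡ 0ℚ
  quantise-zero μ z μz≡0 = trans (cong ι (roundFrom-zero 0ℚ μ z μz≡0)) ι-0

  quantise-isDistribution : ∀ {n} {μ : Fin n → ℚ} → IsDistribution μ → IsDistribution (quantise μ)
  quantise-isDistribution {μ = μ} (μ≥0 , Σμ≡1) = (λ z → ι-nonneg (roundFrom 0ℚ μ z)) , (begin
    sumFin (quantise μ)                ≡⟨ +-identityʳ (sumFin (quantise μ)) ⟨
    sumFin (quantise μ) + 0ℚ           ≡⟨ cong (λ s → sumFin (quantise μ) + s) (trans (cong ι ⌊0⌋) ι-0) ⟨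
    sumFin (quantise μ) + ι ⌊ 0ℚ ·α⌋   ≡⟨ roundFrom-sum ≤-refl μ≥0 ⟩
    ι ⌊ 0ℚ + sumFin μ ·α⌋              ≡⟨ cong (λ s → ι ⌊ s ·α⌋) (trans (+-identityˡ (sumFin μ)) Σμ≡1) ⟩
    ι ⌊ 1ℚ ·α⌋                         ≡⟨ cong ι ⌊1⌋ ⟩
    ι α                                ≡⟨ ι-α ⟩
    1ℚ                                 ∎)
    where open ≡-Reasoning

  quantise-onGrid : ∀ {n} {μ : Fin n → ℚ} → IsDistribution μ →
                    ∀ z → ∃ λ i → i ℕ.≤ α × quantise μ z ≡ (+ i) / α
  quantise-onGrid {μ = μ} μ-dist z = roundFrom 0ℚ μ z , ι-cancel-≤ qz≤ια , ι≡i/α (roundFrom 0ℚ μ z)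
    where
    q-dist : IsDistribution (quantise μ)
    q-dist = quantise-isDistribution μ-dist
    qz≤ια : quantise μ z ℚ.≤ ι α
    qz≤ια = ≤-trans (term≤sumFin (proj₁ q-dist) z) (≤-reflexive (trans (proj₂ q-dist) (sym ι-α)))

  quantise-error-within : ∀ {n} {μ : Fin n → ℚ} → (∀ z → 0ℚ ℚ.≤ μ z) →
                          (S : Fin n → Bool) → (∀ z → μ z ≢ 0ℚ → S z ≡ true) →
                          ∀ z → ∣ quantise μ z - μ z ∣ ℚ.≤ (if S z then ι 1 else 0ℚ)
  quantise-error-within {μ = μ} μ≥0 S supp z with S z in Sz
  ... | true  = <⇒≤ (roundFrom-error ≤-refl μ≥0 z)
  ... | false = ≤-reflexive (cong₂ (λ a b → ∣ a - b ∣) (quantise-zero μ z μz≡0) μz≡0)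
    where
    μz≡0 : μ z ≡ 0ℚ
    μz≡0 = decidable-stable (μ z ≟ 0ℚ) (λ μz≢0 → contradiction (trans (sym Sz) (supp z μz≢0)) λ ())

  quantise-dist1 : ∀ {n} {μ : Fin n → ℚ} → (∀ z → 0ℚ ℚ.≤ μ z) →
                   (S : Fin n → Bool) → (∀ z → μ z ≢ 0ℚ → S z ≡ true) →
                   dist1 (quantise μ) μ ℚ.≤ ι (countFin S)
  quantise-dist1 {μ = μ} μ≥0 S supp = begin
    dist1 (quantise μ) μ                        ≤⟨ sumFin-mono (quantise-error-within μ≥0 S supp) ⟩
    sumFin (λ z → if S z then ι 1 else 0ℚ)      ≡⟨ sumFin-indicator S ⟩
    ι (countFin S)                              ∎
    where open ≤-Reasoning

  quantise-uniform : ∀ {G ε r M} {f : VMap G} → (∀ x → ballSize G r x ℕ.≤ M) →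
                     IsUniformMap G ε r f → IsUniformMap G (ε + (ι M + ι M)) r (λ x → quantise (f x))
  quantise-uniform {G} {ε} {r} {M} {f} ball≤M (f-dist , f-close , f-supp) =
    (λ x → quantise-isDistribution (f-dist x)) , g-close , g-supp
    where
    g : VMap G
    g x = quantise (f x)

    rounding≤M : ∀ x → dist1 (g x) (f x) ℚ.≤ ι M
    rounding≤M x with f-dist x
    ... | fx≥0 , _ = ≤-trans (quantise-dist1 fx≥0 (within G r x) (f-supp x)) (ι-mono-≤ (ball≤M x))

    g-close : ∀ x y → adj G x y ≡ true → dist1 (g x) (g y) ℚ.< ε + (ι M + ι M)
    g-close x y x~y = begin-strict
      dist1 (g x) (g y)                                              ≤⟨ dist1-triangle (g x) (f x) (g y) ⟩
      dist1 (g x) (f x) + dist1 (f x) (g y)                          ≤⟨ +-monoʳ-≤ (dist1 (g x) (f x)) (dist1-triangle (f x) (f y) (g y)) ⟩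
      dist1 (g x) (f x) + (dist1 (f x) (f y) + dist1 (f y) (g y))    ≡⟨ cong (λ s → dist1 (g x) (f x) + (dist1 (f x) (f y) + s)) (dist1-sym (f y) (g y)) ⟩
      dist1 (g x) (f x) + (dist1 (f x) (f y) + dist1 (g y) (f y))    <⟨ +-mono-≤-< (rounding≤M x) (+-mono-<-≤ (f-close x y x~y) (rounding≤M y)) ⟩
      ι M + (ε + ι M)                                                ≡⟨ solve 2 (λ m e → m :+ (e :+ m) := e :+ (m :+ m)) refl (ι M) ε ⟩
      ε + (ι M + ι M)                                                ∎
      where open ≤-Reasoning

    g-supp : ∀ x → SuppIn G r x (g x)
    g-supp x z gxz≢0 with f x z ≟ 0ℚ
    ... | yes fxz≡0 = contradiction (quantise-zero (f x) z fxz≡0) gxz≢0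
    ... | no  fxz≢0 = f-supp x z fxz≢0

corollary5p3 : (d r : ℕ) → 1 ℕ.< d → 1 ℕ.≤ r → (ε ε' : ℚ) → 0ℚ ℚ.< ε → ε ℚ.< ε' → ε' ℚ.< 1ℚ
    → (M : ℕ) → IsMaxBallSize d r M
    → (α : ℕ) → .{{_ : NonZero α}} → (+ (3 ℕ.* M) / 1) ℚ.< (ε' - ε) * (+ α / 1)
    → (G : Graph) → InA d ε r G
    → Σ (VMap G) λ g →
        (∀ x z → ∃ λ i → i ℕ.≤ α × g x z ≡ (+ i) / α)
        × IsUniformMap G ε' r g
corollary5p3 _ _ _ _ _ _ _ _ _ _ _ zero ⦃ α≢0 ⦄ = Irrelevant.⊥-elim (ℕ.NonZero.nonZero α≢0)
corollary5p3 d r _ _ ε ε' _ _ _ M (ball≤M , _) (suc k) 3M<[ε'-ε]α G (G∈Gr , f , f-uniform@(f-dist , _)) =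
  (λ x → quantise (f x)) ,
  (λ x → quantise-onGrid (f-dist x)) ,
  IsUniformMap-mono {G} {r = r} tolerance (quantise-uniform {G} {ε} {r} (ball≤M G G∈Gr) f-uniform)
  where
  open Grid k
  tolerance : ε + (ι M + ι M) ℚ.≤ ε'
  tolerance = begin
    ε + (ι M + ι M)     ≡⟨ cong (λ s → ε + s) (ι-+ M M) ⟨
    ε + ι (M ℕ.+ M)     ≤⟨ +-monoʳ-≤ ε (ι-mono-≤ M+M≤3M) ⟩
    ε + ι (3 ℕ.* M)     <⟨ +-monoʳ-< ε (n<q*α⇒ι[n]<q 3M<[ε'-ε]α) ⟩
    ε + (ε' - ε)        ≡⟨ solve 2 (λ e e' → e :+ (e' :- e) := e') refl ε ε' ⟩
    ε'                  ∎
    where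
    open ≤-Reasoning
    M+M≤3M : M ℕ.+ M ℕ.≤ 3 ℕ.* M
    M+M≤3M = ℕ.+-monoʳ-≤ M (ℕ.m≤m+n M (M ℕ.+ 0))
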